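{- Let $r\ge1$, $n\ge1$. In $\mathbb{C}[\mathcal{B}_n^*]$, every multichain monomial $y=y_{S_1}\cdots y_{S_t}$ (with $\emptyset\ne S_1\subseteq\cdots\subseteq S_t\subseteq[n]$) is equal to $\tilde b_{(g,d)}$ for a unique pair $(g,d)\in G_n\times\mathbb{Z}_{\ge0}^n$.
   Context: $\mathbb{C}[\mathbf{y}_S]$ is the polynomial ring in variables $y_S$, $\emptyset\ne S\subseteq[n]$, and $\mathbb{C}[\mathcal{B}_n^*]=\mathbb{C}[\mathbf{y}_S]/\langle y_Sy_T: S\not\subseteq T,\,T\not\subseteq S\rangle$ (Stanley–Reisner ring of the Boolean algebra). Elements of $G_n=G(r,1,n)$ are identified with $r$-colored permutations $g=\sigma_1^{c_1}\cdots\sigma_n^{c_n}$ ($\sigma\in\mathfrak{S}_n$, $c_i\in\{0,\dots,r-1\}$). Letters $i^c$ are ordered by $i^c<j^d$ iff $c>d$, or $c=d$ and $i<j$; $\mathrm{Des}(g)=\{1\le i\le n-1:\sigma_i^{c_i}>\sigma_{i+1}^{c_{i+1}}\}$. Define $\tilde b_g=\prod_{i=1}^n y_{T_i}^{m_i}$ with $T_i=\{\sigma_1,\dots,\sigma_i\}$, $m_i=c_i-c_{i+1}+r$ if $i<n$, $i\in\mathrm{Des}(g)$; $m_i=c_i-c_{i+1}$ if $i<n$, $i\notin\mathrm{Des}(g)$; $m_n=c_n$. For $d\in\mathbb{Z}_{\ge0}^n$, $\tilde b_{(g,d)}=\tilde b_g\prod_{i=1}^n y_{T_i}^{rd_i}$.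 -}

module Defs where

open import Data.Nat using (ℕ; zero; suc; _+_; _*_; _∸_; _≤ᵇ_; _<_; _≤_)
open import Data.Nat.Properties using (_<?_)
open import Data.Bool using (Bool; true; false; if_then_else_)
open import Data.Bool.Properties using () renaming (_≟_ to _≟B_)
open import Data.Fin using (Fin; toℕ; fromℕ<)
open import Data.Fin.Subset using (Subset; _⊆_; _⊈_; Nonempty)
open import Data.Fin.Permutation using (Permutation′; _⟨$⟩ʳ_; _⟨$⟩ˡ_)
open import Data.Vec using (tabulate)
open import Data.Vec.Properties using (≡-dec)
open import Data.List using (List; []; _∷_; map; allFin)
open import Data.Nat.ListAction using (sum)
open import Data.List.Relation.Unary.All using (All)
open import Data.List.Relation.Unary.Linked using (Linked)
open import Data.Product using (Σ; ∃; _×_; _,_)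
open import Data.Sum using (_⊎_)
open import Relation.Nullary using (yes; no; ¬_)
open import Relation.Nullary.Decidable using (⌊_⌋)
open import Relation.Binary.PropositionalEquality using (_≡_)

-- Monomials in the variables y_S (S ⊆ [n]) are exponent functions.
-- (Only nonempty S ever get a nonzero exponent below.)
Monomial : ℕ → Set
Monomial n = Subset n → ℕ

_==S_ : ∀ {n} → Subset n → Subset n → Bool
S ==S T = ⌊ ≡-dec _≟B_ S T ⌋

prodY : ∀ {n} → List (Subset n) → Monomial n
prodY []       S = 0
prodY (T ∷ Ts) S = (if T ==S S then 1 else 0) + prodY Ts S

IsMultichain : ∀ {n} → List (Subset n) → Set
IsMultichain Ss = All Nonempty Ss × Linked _⊆_ Ss

-- A monomial lies in the Stanley–Reisner ideal ⟨ y_S y_T : S, T incomparable ⟩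
-- iff it is divisible by some y_S y_T with S, T incomparable.
InSRIdeal : ∀ {n} → Monomial n → Set
InSRIdeal {n} m = Σ (Subset n) λ S → Σ (Subset n) λ T →
  (1 ≤ m S) × (1 ≤ m T) × (S ⊈ T) × (T ⊈ S)

-- Equality of two monomials in ℂ[B_n^*] = ℂ[y_S]/I (I a monomial ideal):
-- m - m' ∈ I  iff  m = m'  or both m, m' ∈ I.
_≈SR_ : ∀ {n} → Monomial n → Monomial n → Set
m ≈SR m' = (∀ S → m S ≡ m' S) ⊎ (InSRIdeal m × InSRIdeal m')

-- r-colored permutations g = σ₁^{c₁} ⋯ σₙ^{cₙ}; positions are 0-indexed Fin n
record ColPerm (r n : ℕ) : Set where
  constructor colperm
  field
    σ : Permutation′ n
    c : Fin n → Fin r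

open ColPerm public

letterLt : ∀ {r n} → (Fin n × Fin r) → (Fin n × Fin r) → Bool
letterLt (i , c) (j , d) =
  if ⌊ toℕ d <? toℕ c ⌋ then true
  else (if ⌊ toℕ c <? toℕ d ⌋ then false else ⌊ toℕ i <? toℕ j ⌋)

letter : ∀ {r n} → ColPerm r n → Fin n → Fin n × Fin r
letter g k = (σ g ⟨$⟩ʳ k , c g k)

-- T_k = {σ_1, …, σ_k}; for 0-indexed position k this is {σ_0, …, σ_k}
Tset : ∀ {r n} → ColPerm r n → Fin n → Subset n
Tset g k = tabulate (λ j → toℕ (σ g ⟨$⟩ˡ j) ≤ᵇ toℕ k)

-- exponent m_k (0-indexed k; the last position is k = n-1)
--   descent at k : c_k - c_{k+1} + r   (written (r + c_k) ∸ c_{k+1}, which is ≥ 1 here)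
--   ascent  at k : c_k - c_{k+1}       (≥ 0 here)
--   last        : c_{n}
mexp : ∀ {r n} → ColPerm r n → Fin n → ℕ
mexp {r} {n} g k with suc (toℕ k) <? n
... | yes p = let k' = fromℕ< p in
              if letterLt (letter g k') (letter g k)
              then (r + toℕ (c g k)) ∸ toℕ (c g k')
              else toℕ (c g k) ∸ toℕ (c g k')
... | no _  = toℕ (c g k)

btilde : ∀ {r n} → ColPerm r n → (Fin n → ℕ) → Monomial n
btilde {r} {n} g d S =
  sum (map (λ k → if Tset g k ==S S then mexp g k + r * d k else 0) (allFin n))

SamePair : ∀ {r n} → (ColPerm r n × (Fin n → ℕ)) → (ColPerm r n × (Fin n → ℕ)) → Set
SamePair (g , d) (g' , d') =
  (∀ i → σ g ⟨$⟩ʳ i ≡ σ g' ⟨$⟩ʳ i) × (∀ i → c g i ≡ c g' i) × (∀ i → d i ≡ d' i)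

-- A multichain S₁ ⊆ ⋯ ⊆ S_t of nonempty subsets of [n] is determined by its height function
-- h(j) = #{i : j ∈ Sᵢ}, and multichain monomials are not in the Stanley–Reisner ideal, so
-- equality in ℂ[B_n^*] is equality of multichains.  The monomial b̃_(g,d) is the multichain
-- y_{T₁}^{e₁} ⋯ y_{Tₙ}^{eₙ} with eₖ = mₖ + r dₖ, whose height at σₖ is eₖ + ⋯ + eₙ.  Hence
-- it suffices that (g,d) ↦ height is a bijection onto ℕ^[n].  A zero exponent forces an
-- ascent, so σ lists [n] by decreasing height with ties broken increasingly; telescoping the
-- mₖ gives height(σₖ) ≡ cₖ (mod r), which fixes the colours, and then the dₖ.  Conversely,
-- sort [n] by height and take cₖ = height(σₖ) mod r: the dₖ this forces are natural numbers
-- because a descent at k makes the quotient height(σₖ)/r drop strictly.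
{-# OPTIONS --safe #-}
module Submission where

open import Defs
open import Data.Bool using (Bool; true; false; if_then_else_)
open import Data.Bool.Properties using (T-≡) renaming (_≟_ to _≟B_)
open import Data.Fin as Fin using (Fin; zero; suc; toℕ; fromℕ<; punchOut)
open import Data.Fin.Properties
  using (toℕ-fromℕ<; fromℕ<-toℕ; toℕ<n; toℕ-injective; any?; injective⇒≤; punchOut-injective)
import Data.Fin.Properties as Finₚ
open import Data.Fin.Permutation
  using (Permutation′; _⟨$⟩ʳ_; _⟨$⟩ˡ_; inverseˡ; inverseʳ; permutation)
open import Data.Fin.Subset using (Subset; _⊆_; _∈_; Nonempty)
open import Data.Fin.Subset.Properties using (⊆-refl; ⊆-trans; ⊆-antisym)
open import Data.List using (List; []; _∷_; _++_; map; replicate; length; concat; tabulate; allFin)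
open import Data.List.Properties using (map-++; map-replicate; map-tabulate)
open import Data.List.Membership.Propositional using () renaming (_∈_ to _∈ₗ_)
open import Data.List.Membership.Propositional.Properties using (∈-∃++)
open import Data.List.Relation.Binary.Permutation.Propositional
  using (_↭_; prep; ↭-sym; ↭-trans; ↭-refl)
import Data.List.Relation.Binary.Permutation.Propositional.Properties as ↭
open import Data.List.Relation.Unary.All as All using (All; []; _∷_)
import Data.List.Relation.Unary.All.Properties as All
open import Data.List.Relation.Unary.AllPairs using (AllPairs; []; _∷_)
import Data.List.Relation.Unary.AllPairs.Properties as AllPairs
open import Data.List.Relation.Unary.Any using (here; there)
open import Data.List.Relation.Unary.Linked as Linked using (Linked)
open import Data.List.Relation.Unary.Linked.Properties using (Linked⇒AllPairs; AllPairs⇒Linked)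
open import Data.Nat
  using (ℕ; zero; suc; _+_; _*_; _∸_; _≤_; _<_; _>_; _≤ᵇ_; z≤n; s≤s; z<s; s<s; NonZero)
open import Data.Nat.DivMod
  using (_%_; _/_; _mod_; m%n<n; m≡m%n+[m/n]*n; [m+kn]%n≡m%n; m<n⇒m%n≡m; /-monoˡ-≤)
open import Data.Nat.ListAction using (sum)
open import Data.Nat.ListAction.Properties using (sum-++; sum-↭)
open import Data.Nat.Properties
import Data.Nat.Properties as ℕₚ
open import Data.Product using (Σ; ∃-syntax; _×_; _,_; proj₁; proj₂)
open import Data.Product.Relation.Binary.Lex.Strict using (×-Lex; ×-isStrictTotalOrder)
open import Data.Product.Relation.Binary.Pointwise.NonDependent using (Pointwise)
open import Data.Sum using (_⊎_; inj₁; inj₂)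
open import Data.Vec using (lookup)
open import Data.Vec.Properties using (≡-dec; []=⇒lookup; lookup⇒[]=; lookup∘tabulate)
open import Function using (_∘_; id; _on_; Injective; _⇔_; mk⇔)
open import Function.Bundles using (Equivalence)
open import Level using (0ℓ)
open import Relation.Binary using (Rel; Transitive; IsStrictTotalOrder; tri<; tri≈; tri>)
import Relation.Binary.Construct.Flip.EqAndOrd as Flip
import Relation.Binary.Construct.On as On
open import Relation.Binary.PropositionalEquality
open import Relation.Nullary using (¬_; Dec; yes; no; does; contradiction)
open import Relation.Nullary.Decidable using (dec-true; dec-false; does-⇔)
open import Algebra.Properties.CommutativeSemigroup +-commutativeSemigroup
  using (interchange; xy∙z≈xz∙y)
open import Algebra.Properties.CommutativeMonoid.Sum +-0-commutativeMonoid
  using (sum-syntax; sum-cong-≗; sum-permute) renaming (sum to ∑)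

𝟙 : Bool → ℕ
𝟙 b = if b then 1 else 0

𝟙≤1 : ∀ b → 𝟙 b ≤ 1
𝟙≤1 true  = ≤-refl
𝟙≤1 false = z≤n

𝟙-mono : ∀ {A B : Set} → (A → B) → (a? : Dec A) (b? : Dec B) → 𝟙 (does a?) ≤ 𝟙 (does b?)
𝟙-mono A→B (yes _) (yes _) = ≤-refl
𝟙-mono A→B (yes a) (no ¬b) = contradiction (A→B a) ¬b
𝟙-mono A→B (no _)  _       = z≤n

tally : {A : Set} → (A → Bool) → List A → ℕ
tally p xs = sum (map (𝟙 ∘ p) xs)

module _ {A : Set} (p : A → Bool) where

  tally-++ : ∀ xs ys → tally p (xs ++ ys) ≡ tally p xs + tally p ys
  tally-++ xs ys = trans (cong sum (map-++ (𝟙 ∘ p) xs ys)) (sum-++ (map (𝟙 ∘ p) xs) _)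

  tally-replicate : ∀ e x → tally p (replicate e x) ≡ (if p x then e else 0)
  tally-replicate e x = trans (cong sum (map-replicate (𝟙 ∘ p) e x)) (sum-replicate-𝟙 e (p x))
    where
    sum-replicate-𝟙 : ∀ e b → sum (replicate e (𝟙 b)) ≡ (if b then e else 0)
    sum-replicate-𝟙 zero    true  = refl
    sum-replicate-𝟙 zero    false = refl
    sum-replicate-𝟙 (suc e) true  = cong suc (sum-replicate-𝟙 e true)
    sum-replicate-𝟙 (suc e) false = sum-replicate-𝟙 e false

  tally-↭ : ∀ {xs ys} → xs ↭ ys → tally p xs ≡ tally p ys
  tally-↭ xs↭ys = sum-↭ (↭.map⁺ (𝟙 ∘ p) xs↭ys)

∑-allFin : ∀ {n} (h : Fin n → ℕ) → sum (map h (allFin n)) ≡ ∑[ k < n ] h k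
∑-allFin h = trans (cong sum (map-tabulate id h)) (sum-tabulate h)
  where
  sum-tabulate : ∀ {n} (h : Fin n → ℕ) → sum (tabulate h) ≡ ∑[ k < n ] h k
  sum-tabulate {zero}  h = refl
  sum-tabulate {suc n} h = cong (h zero +_) (sum-tabulate (h ∘ suc))

∑-mono-≤ : ∀ {n} {f g : Fin n → ℕ} → (∀ i → f i ≤ g i) → ∑[ i < n ] f i ≤ ∑[ i < n ] g i
∑-mono-≤ {zero}  f≤g = z≤n
∑-mono-≤ {suc n} f≤g = +-mono-≤ (f≤g zero) (∑-mono-≤ (f≤g ∘ suc))

∑-mono-< : ∀ {n} {f g : Fin n → ℕ} → (∀ i → f i ≤ g i) → ∀ a → f a < g a →
           ∑[ i < n ] f i < ∑[ i < n ] g i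
∑-mono-< {suc n} f≤g zero    fa<ga = +-mono-<-≤ fa<ga (∑-mono-≤ (f≤g ∘ suc))
∑-mono-< {suc n} f≤g (suc a) fa<ga = +-mono-≤-< (f≤g zero) (∑-mono-< (f≤g ∘ suc) a fa<ga)

∑-const-1 : ∀ n → ∑[ i < n ] 1 ≡ n
∑-const-1 zero    = refl
∑-const-1 (suc n) = cong suc (∑-const-1 n)

∑-count-< : ∀ {n} m → m ≤ n → ∑[ k < n ] 𝟙 (does (toℕ k <? m)) ≡ m
∑-count-< {zero}  zero    _         = refl
∑-count-< {suc n} zero    _         = ∑-count-< {n} zero z≤n
∑-count-< {suc n} (suc m) (s≤s m≤n) = cong suc (∑-count-< m m≤n)

+-*-regroup : ∀ r c u v → c + r * u + r * v ≡ c + r * (u + v)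
+-*-regroup r c u v = trans (+-assoc c (r * u) (r * v)) (cong (c +_) (sym (*-distribˡ-+ r u v)))

+-*-carry : ∀ r {a b c u q′ t q} → a + b ≡ c + r * u → u + q′ + t ≡ q →
            a + r * t + (b + r * q′) ≡ c + r * q
+-*-carry r {a} {b} {c} {u} {q′} {t} {q} a+b≡c+ru u+q′+t≡q = begin
  a + r * t + (b + r * q′)  ≡⟨ interchange a (r * t) b (r * q′) ⟩
  a + b + (r * t + r * q′)  ≡⟨ cong₂ _+_ a+b≡c+ru (sym (*-distribˡ-+ r t q′)) ⟩
  c + r * u + r * (t + q′)  ≡⟨ +-*-regroup r c u (t + q′) ⟩
  c + r * (u + (t + q′))    ≡⟨ cong (λ x → c + r * (u + x)) (+-comm t q′) ⟩
  c + r * (u + (q′ + t))    ≡⟨ cong (λ x → c + r * x) (trans (sym (+-assoc u q′ t)) u+q′+t≡q) ⟩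
  c + r * q                 ∎
  where open ≡-Reasoning

module _ {r : ℕ} .{{_ : NonZero r}} where

  mod-div-decomposition : ∀ m → m ≡ toℕ (m mod r) + r * (m / r)
  mod-div-decomposition m =
    trans (m≡m%n+[m/n]*n m r) (cong₂ _+_ (sym (toℕ-fromℕ< (m%n<n m r))) (*-comm (m / r) r))

  [m+r*k]%r≡m : ∀ m k → m < r → (m + r * k) % r ≡ m
  [m+r*k]%r≡m m k m<r =
    trans (cong (λ x → (m + x) % r) (*-comm r k)) (trans ([m+kn]%n≡m%n m k r) (m<n⇒m%n≡m m<r))

-- Multichains and their heights

module _ {n : ℕ} where

  height : List (Subset n) → Fin n → ℕ
  height L j = tally (λ S → lookup S j) L

  prodY≡tally : ∀ L (S : Subset n) → prodY L S ≡ tally (_==S S) L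
  prodY≡tally []      S = refl
  prodY≡tally (T ∷ L) S = cong (𝟙 (T ==S S) +_) (prodY≡tally L S)

  prodY-↭ : ∀ {A B} → A ↭ B → prodY A ≗ prodY B
  prodY-↭ {A} {B} A↭B S = begin
    prodY A S          ≡⟨ prodY≡tally A S ⟩
    tally (_==S S) A   ≡⟨ tally-↭ (_==S S) A↭B ⟩
    tally (_==S S) B   ≡⟨ prodY≡tally B S ⟨
    prodY B S          ∎
    where open ≡-Reasoning

  prodY-pos⇒∈ : ∀ L (S : Subset n) → 1 ≤ prodY L S → S ∈ₗ L
  prodY-pos⇒∈ (T ∷ L) S pos with ≡-dec _≟B_ T S
  ... | yes refl = here refl
  ... | no  _    = there (prodY-pos⇒∈ L S pos)

  prodY-head-pos : ∀ (S : Subset n) L → 1 ≤ prodY (S ∷ L) S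
  prodY-head-pos S L with ≡-dec _≟B_ S S
  ... | yes _   = s≤s z≤n
  ... | no  S≢S = contradiction refl S≢S

  prodY≗⇒↭ : ∀ A B → prodY A ≗ prodY B → A ↭ B
  prodY≗⇒↭ []      []      _ = ↭-refl
  prodY≗⇒↭ []      (U ∷ B) e with () ← subst (1 ≤_) (sym (e U)) (prodY-head-pos U B)
  prodY≗⇒↭ (T ∷ A) B       e
    with ys , zs , refl ← ∈-∃++ (prodY-pos⇒∈ B T (subst (1 ≤_) (e T) (prodY-head-pos T A)))
    = ↭-trans (prep T (prodY≗⇒↭ A (ys ++ zs) e′)) (↭-sym (↭.shift T ys zs))
    where
    e′ : prodY A ≗ prodY (ys ++ zs)
    e′ S = +-cancelˡ-≡ (𝟙 (T ==S S)) _ _ (trans (e S) (prodY-↭ (↭.shift T ys zs) S))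

  height≤length : ∀ L j → height L j ≤ length L
  height≤length []      j = z≤n
  height≤length (S ∷ L) j = +-mono-≤ (𝟙≤1 (lookup S j)) (height≤length L j)

  height-common-member : ∀ {L} j → All (j ∈_) L → height L j ≡ length L
  height-common-member j []          = refl
  height-common-member j (j∈S ∷ j∈L) =
    cong₂ _+_ (cong 𝟙 ([]=⇒lookup j∈S)) (height-common-member j j∈L)

  ∈-head⇒full-height : ∀ {S L} j → Linked _⊆_ (S ∷ L) → j ∈ S →
                       height (S ∷ L) j ≡ length (S ∷ L)
  ∈-head⇒full-height j chain j∈S with S⊆L ∷ _ ← Linked⇒AllPairs ⊆-trans chain =
    height-common-member j (j∈S ∷ All.map (λ S⊆T → S⊆T j∈S) S⊆L)

  full-height⇒∈-head : ∀ S L j → height (S ∷ L) j ≡ length (S ∷ L) → j ∈ S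
  full-height⇒∈-head S L j full with lookup S j in S[j]
  ... | true  = lookup⇒[]= j S S[j]
  ... | false = contradiction (subst (_≤ length L) full (height≤length L j)) 1+n≰n

  length≤-of-equal-heights : ∀ S A B → IsMultichain (S ∷ A) → height (S ∷ A) ≗ height B →
                             length (S ∷ A) ≤ length B
  length≤-of-equal-heights S A B ((j , j∈S) ∷ _ , chain) e =
    subst (_≤ length B) (trans (sym (e j)) (∈-head⇒full-height j chain j∈S)) (height≤length B j)

  equal-heights⇒same-length : ∀ S A U B → IsMultichain (S ∷ A) → IsMultichain (U ∷ B) →
                              height (S ∷ A) ≗ height (U ∷ B) → length (S ∷ A) ≡ length (U ∷ B)
  equal-heights⇒same-length S A U B mcA mcB e = ≤-antisym
    (length≤-of-equal-heights S A (U ∷ B) mcA e) (length≤-of-equal-heights U B (S ∷ A) mcB (sym ∘ e))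

  equal-heights⇒head-⊆ : ∀ S A U B → Linked _⊆_ (S ∷ A) → height (S ∷ A) ≗ height (U ∷ B) →
                         length (S ∷ A) ≡ length (U ∷ B) → S ⊆ U
  equal-heights⇒head-⊆ S A U B chain e same-length {j} j∈S =
    full-height⇒∈-head U B j (trans (sym (e j)) (trans (∈-head⇒full-height j chain j∈S) same-length))

  multichain-height-injective : ∀ A B → IsMultichain A → IsMultichain B → height A ≗ height B → A ≡ B
  multichain-height-injective []      []      _   _   _ = refl
  multichain-height-injective []      (U ∷ B) _   mcB e
    with () ← length≤-of-equal-heights U B [] mcB (sym ∘ e)
  multichain-height-injective (S ∷ A) []      mcA _   e
    with () ← length≤-of-equal-heights S A [] mcA e
  multichain-height-injective (S ∷ A) (U ∷ B) mcA@(neA , chainA) mcB@(neB , chainB) e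
    with same-length ← equal-heights⇒same-length S A U B mcA mcB e
    with refl ← ⊆-antisym (equal-heights⇒head-⊆ S A U B chainA e same-length)
                          (equal-heights⇒head-⊆ U B S A chainB (sym ∘ e) (sym same-length)) =
    cong (S ∷_) (multichain-height-injective A B (All.tail neA , Linked.tail chainA)
                                                 (All.tail neB , Linked.tail chainB)
                                                 (λ j → +-cancelˡ-≡ (𝟙 (lookup S j)) _ _ (e j)))

  members-comparable : ∀ {L : List (Subset n)} {S T} → AllPairs _⊆_ L → S ∈ₗ L → T ∈ₗ L →
                       S ⊆ T ⊎ T ⊆ S
  members-comparable (_   ∷ _)  (here refl) (here refl) = inj₁ ⊆-refl
  members-comparable (S⊆L ∷ _)  (here refl) (there T∈L) = inj₁ (All.lookup S⊆L T∈L)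
  members-comparable (T⊆L ∷ _)  (there S∈L) (here refl) = inj₂ (All.lookup T⊆L S∈L)
  members-comparable (_   ∷ ps) (there S∈L) (there T∈L) = members-comparable ps S∈L T∈L

  multichain∉SRIdeal : ∀ {L} → IsMultichain L → ¬ InSRIdeal (prodY L)
  multichain∉SRIdeal {L} (_ , chain) (S , T , S∈L , T∈L , S⊈T , T⊈S)
    with members-comparable (Linked⇒AllPairs ⊆-trans chain) (prodY-pos⇒∈ L S S∈L) (prodY-pos⇒∈ L T T∈L)
  ... | inj₁ S⊆T = S⊈T S⊆T
  ... | inj₂ T⊆S = T⊈S T⊆S

blocks : ∀ {A : Set} {n} → (Fin n → ℕ) → (Fin n → A) → List A
blocks e T = concat (tabulate (λ k → replicate (e k) (T k)))

tally-blocks : ∀ {A : Set} {n} (p : A → Bool) (e : Fin n → ℕ) (T : Fin n → A) →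
               tally p (blocks e T) ≡ ∑[ k < n ] (if p (T k) then e k else 0)
tally-blocks {n = zero}  p e T = refl
tally-blocks {n = suc n} p e T =
  trans (tally-++ p (replicate (e zero) (T zero)) (blocks (e ∘ suc) (T ∘ suc)))
        (cong₂ _+_ (tally-replicate p (e zero) (T zero)) (tally-blocks p (e ∘ suc) (T ∘ suc)))

AllPairs-replicate : ∀ {A : Set} {R : Rel A 0ℓ} {x} e → R x x → AllPairs R (replicate e x)
AllPairs-replicate zero    Rxx = []
AllPairs-replicate (suc e) Rxx = All.replicate⁺ e Rxx ∷ AllPairs-replicate e Rxx

AllPairs-tabulate : ∀ {n} {A : Set} {R : Rel A 0ℓ} {f : Fin n → A} →
                    (∀ {i j} → i Fin.< j → R (f i) (f j)) → AllPairs R (tabulate f)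
AllPairs-tabulate {zero}  _    = []
AllPairs-tabulate {suc n} R-<  = All.tabulate⁺ (λ _ → R-< z<s) ∷ AllPairs-tabulate (λ i<j → R-< (s<s i<j))

blocks-isMultichain : ∀ {m n} (e : Fin n → ℕ) (T : Fin n → Subset m) → (∀ k → Nonempty (T k)) →
                      (∀ {k k′} → k Fin.< k′ → T k ⊆ T k′) → IsMultichain (blocks e T)
blocks-isMultichain e T nonempty mono =
  All.concat⁺ (All.tabulate⁺ (λ k → All.replicate⁺ (e k) (nonempty k))) ,
  AllPairs⇒Linked (AllPairs.concat⁺ (All.tabulate⁺ (λ k → AllPairs-replicate (e k) ⊆-refl))
                    (AllPairs-tabulate (λ k<k′ → All.replicate⁺ _ (All.replicate⁺ _ (mono k<k′)))))

-- Extension of h by zero beyond n, so that the last position needs no special case.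
at : ∀ {n} → (Fin n → ℕ) → ℕ → ℕ
at {zero}  h _       = 0
at {suc n} h zero    = h zero
at {suc n} h (suc m) = at (h ∘ suc) m

at-fromℕ< : ∀ {n} (h : Fin n → ℕ) {m} (m<n : m < n) → at h m ≡ h (fromℕ< m<n)
at-fromℕ< {suc n} h {zero}  _         = refl
at-fromℕ< {suc n} h {suc m} (s<s m<n) = at-fromℕ< (h ∘ suc) m<n

at-toℕ : ∀ {n} (h : Fin n → ℕ) k → at h (toℕ k) ≡ h k
at-toℕ h k = trans (at-fromℕ< h (toℕ<n k)) (cong h (fromℕ<-toℕ k (toℕ<n k)))

at-≥ : ∀ {n} (h : Fin n → ℕ) {m} → n ≤ m → at h m ≡ 0
at-≥ {zero}  h         _         = refl
at-≥ {suc n} h {suc m} (s≤s n≤m) = at-≥ (h ∘ suc) n≤m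

tailSum : ∀ {n} → (Fin n → ℕ) → ℕ → ℕ
tailSum {n} h m = ∑[ k < n ] (if m ≤ᵇ toℕ k then h k else 0)

tailSum-step : ∀ {n} (h : Fin n → ℕ) m → tailSum h m ≡ at h m + tailSum h (suc m)
tailSum-step {zero}  h m             = refl
tailSum-step {suc n} h zero          = refl
tailSum-step {suc n} h (suc zero)    = tailSum-step (h ∘ suc) zero
tailSum-step {suc n} h (suc (suc m)) = tailSum-step (h ∘ suc) (suc m)

tailSum-suc : ∀ {n} (h : Fin (suc n) → ℕ) m → tailSum h (suc m) ≡ tailSum (h ∘ suc) m
tailSum-suc h zero    = refl
tailSum-suc h (suc m) = refl

tailSum-injective : ∀ {n} {h h′ : Fin n → ℕ} →
                    (∀ (k : Fin n) → tailSum h (toℕ k) ≡ tailSum h′ (toℕ k)) → h ≗ h′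
tailSum-injective {suc n} {h} {h′} e = λ where
    zero    → +-cancelʳ-≡ _ (h zero) (h′ zero)
                (trans (e zero) (cong (h′ zero +_) (sym (sum-cong-≗ h∘suc≗h′∘suc))))
    (suc k) → h∘suc≗h′∘suc k
  where
  h∘suc≗h′∘suc : h ∘ suc ≗ h′ ∘ suc
  h∘suc≗h′∘suc = tailSum-injective λ k →
    trans (sym (tailSum-suc h (toℕ k))) (trans (e (suc k)) (tailSum-suc h′ (toℕ k)))

tailSum-telescope : ∀ r {n} (a C : Fin n → ℕ) →
                    (∀ k → ∃[ D ] a k + at C (suc (toℕ k)) ≡ C k + r * D) →
                    ∀ m → ∃[ Q ] tailSum a m ≡ at C m + r * Q
tailSum-telescope r {zero}  a C step m       = 0 , sym (*-zeroʳ r)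
tailSum-telescope r {suc n} a C step (suc m)
  with Q , eq ← tailSum-telescope r (a ∘ suc) (C ∘ suc) (step ∘ suc) m = Q , trans (tailSum-suc a m) eq
tailSum-telescope r {suc n} a C step zero
  with D , eqD ← step zero
     | Q , eqQ ← tailSum-telescope r (a ∘ suc) (C ∘ suc) (step ∘ suc) zero = D + Q , (begin
  a zero + tailSum (a ∘ suc) 0  ≡⟨ cong (a zero +_) eqQ ⟩
  a zero + (at C 1 + r * Q)     ≡⟨ +-assoc (a zero) _ _ ⟨
  a zero + at C 1 + r * Q       ≡⟨ cong (_+ r * Q) eqD ⟩
  C zero + r * D + r * Q        ≡⟨ +-*-regroup r (C zero) D Q ⟩
  C zero + r * (D + Q)          ∎)
  where open ≡-Reasoning

tailSum-of-differences : ∀ {n} (a F : Fin n → ℕ) → (∀ k → a k + at F (suc (toℕ k)) ≡ F k) →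
                         ∀ m → tailSum a m ≡ at F m
tailSum-of-differences {zero}  a F step m       = refl
tailSum-of-differences {suc n} a F step zero    =
  trans (cong (a zero +_) (tailSum-of-differences (a ∘ suc) (F ∘ suc) (step ∘ suc) zero)) (step zero)
tailSum-of-differences {suc n} a F step (suc m) =
  trans (tailSum-suc a m) (tailSum-of-differences (a ∘ suc) (F ∘ suc) (step ∘ suc) m)

-- Sorting by height

ascending-if-adjacent : ∀ {n} {A : Set} {R : Rel A 0ℓ} → Transitive R → (h : Fin n → A) →
                        (∀ {k k′} → toℕ k′ ≡ suc (toℕ k) → R (h k) (h k′)) →
                        ∀ {k k′} → k Fin.< k′ → R (h k) (h k′)
ascending-if-adjacent {suc n} {R = R} trans h adj {k} {k′} = ascending k k′
  where
  tail-ascending : ∀ {k k′} → k Fin.< k′ → R (h (suc k)) (h (suc k′))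
  tail-ascending =
    ascending-if-adjacent {R = R} trans (h ∘ suc) (λ {k} {k′} → adj {suc k} {suc k′} ∘ cong suc)
  ascending : ∀ k k′ → k Fin.< k′ → R (h k) (h k′)
  ascending zero    (suc zero)    _         = adj refl
  ascending zero    (suc (suc j)) _         = trans (adj refl) (tail-ascending {zero} {suc j} z<s)
  ascending (suc i) (suc j)       (s<s i<j) = tail-ascending i<j

injective⇒surjective : ∀ {n} (h : Fin n → Fin n) → Injective _≡_ _≡_ h → ∀ k → ∃[ j ] h j ≡ k
injective⇒surjective {suc n} h h-inj k with any? (λ j → h j Fin.≟ k)
... | yes found = found
... | no  none  = contradiction (injective⇒≤ punchOut∘h-injective) 1+n≰n
  where
  misses-k : ∀ j → k ≢ h j
  misses-k j k≡hj = none (j , sym k≡hj)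
  punchOut∘h-injective : Injective _≡_ _≡_ (λ j → punchOut (misses-k j))
  punchOut∘h-injective {i} {j} = h-inj ∘ punchOut-injective (misses-k i) (misses-k j)

module SortByHeight {n : ℕ} (f : Fin n → ℕ) where

  infix 4 _≺_

  _≺_ : Rel (Fin n) 0ℓ
  _≺_ = ×-Lex _≡_ _>_ Fin._<_ on (λ a → f a , a)

  ≺-isStrictTotalOrder : IsStrictTotalOrder (Pointwise _≡_ _≡_ on (λ a → f a , a)) _≺_
  ≺-isStrictTotalOrder = On.isStrictTotalOrder (λ a → f a , a)
    (×-isStrictTotalOrder (Flip.isStrictTotalOrder ℕₚ.<-isStrictTotalOrder) Finₚ.<-isStrictTotalOrder)

  open IsStrictTotalOrder ≺-isStrictTotalOrder public
    using (compare) renaming (trans to ≺-trans; _<?_ to _≺?_; asym to ≺-asym)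

  ≺-irrefl : ∀ {a} → ¬ a ≺ a
  ≺-irrefl = IsStrictTotalOrder.irrefl ≺-isStrictTotalOrder (refl , refl)

  rank : Fin n → ℕ
  rank a = ∑[ b < n ] 𝟙 (does (b ≺? a))

  rank<n : ∀ a → rank a < n
  rank<n a = subst (rank a <_) (∑-const-1 n) (∑-mono-< (λ b → 𝟙≤1 (does (b ≺? a))) a
    (subst (λ b → 𝟙 b < 1) (sym (dec-false (a ≺? a) ≺-irrefl)) z<s))

  rank-mono : ∀ {a b} → a ≺ b → rank a < rank b
  rank-mono {a} {b} a≺b =
    ∑-mono-< (λ x → 𝟙-mono (λ x≺a → ≺-trans x≺a a≺b) (x ≺? a) (x ≺? b)) a
      (subst₂ (λ u v → 𝟙 u < 𝟙 v) (sym (dec-false (a ≺? a) ≺-irrefl)) (sym (dec-true (a ≺? b) a≺b)) z<s)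

  Sorted : Permutation′ n → Set
  Sorted π = ∀ {k k′} → k Fin.< k′ → π ⟨$⟩ʳ k ≺ π ⟨$⟩ʳ k′

  sorted-position≡rank : ∀ π → Sorted π → ∀ a → toℕ (π ⟨$⟩ˡ a) ≡ rank a
  sorted-position≡rank π sorted a = sym (begin
    ∑[ b < n ] 𝟙 (does (b ≺? a))
      ≡⟨ sum-permute _ π ⟩
    ∑[ k < n ] 𝟙 (does (π ⟨$⟩ʳ k ≺? a))
      ≡⟨ sum-cong-≗ (λ k → cong 𝟙 (does-⇔ (before-a⇔ k) (π ⟨$⟩ʳ k ≺? a) (toℕ k <? _))) ⟩
    ∑[ k < n ] 𝟙 (does (toℕ k <? toℕ (π ⟨$⟩ˡ a)))
      ≡⟨ ∑-count-< _ (<⇒≤ (toℕ<n (π ⟨$⟩ˡ a))) ⟩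
    toℕ (π ⟨$⟩ˡ a)
      ∎)
    where
    open ≡-Reasoning
    before-a⇔ : ∀ k → (π ⟨$⟩ʳ k ≺ a) ⇔ (k Fin.< π ⟨$⟩ˡ a)
    before-a⇔ k = mk⇔ to (λ k<p → subst (π ⟨$⟩ʳ k ≺_) (inverseʳ π) (sorted k<p))
      where
      to : π ⟨$⟩ʳ k ≺ a → k Fin.< π ⟨$⟩ˡ a
      to πk≺a with Finₚ.<-cmp k (π ⟨$⟩ˡ a)
      ... | tri< k<p _ _  = k<p
      ... | tri≈ _ refl _ = contradiction (subst (_≺ a) (inverseʳ π) πk≺a) ≺-irrefl
      ... | tri> _ _ p<k  =
        contradiction πk≺a (≺-asym (subst (_≺ π ⟨$⟩ʳ k) (inverseʳ π) (sorted p<k)))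

  sorted-unique : ∀ π π′ → Sorted π → Sorted π′ → ∀ k → π ⟨$⟩ʳ k ≡ π′ ⟨$⟩ʳ k
  sorted-unique π π′ sorted sorted′ k = begin
    π ⟨$⟩ʳ k                     ≡⟨ inverseʳ π′ ⟨
    π′ ⟨$⟩ʳ (π′ ⟨$⟩ˡ (π ⟨$⟩ʳ k)) ≡⟨ cong (π′ ⟨$⟩ʳ_) (toℕ-injective same-position) ⟩
    π′ ⟨$⟩ʳ (π ⟨$⟩ˡ (π ⟨$⟩ʳ k))  ≡⟨ cong (π′ ⟨$⟩ʳ_) (inverseˡ π) ⟩
    π′ ⟨$⟩ʳ k                    ∎
    where
    open ≡-Reasoning
    same-position : toℕ (π′ ⟨$⟩ˡ (π ⟨$⟩ʳ k)) ≡ toℕ (π ⟨$⟩ˡ (π ⟨$⟩ʳ k))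
    same-position = trans (sorted-position≡rank π′ sorted′ _) (sym (sorted-position≡rank π sorted _))

  rankFin : Fin n → Fin n
  rankFin a = fromℕ< (rank<n a)

  toℕ-rankFin : ∀ a → toℕ (rankFin a) ≡ rank a
  toℕ-rankFin a = toℕ-fromℕ< (rank<n a)

  rankFin-injective : Injective _≡_ _≡_ rankFin
  rankFin-injective {a} {b} same with compare a b
  ... | tri< a≺b _ _       = contradiction (rank-mono a≺b) (<-irrefl same-rank)
    where same-rank = trans (sym (toℕ-rankFin a)) (trans (cong toℕ same) (toℕ-rankFin b))
  ... | tri≈ _ (_ , a≡b) _ = a≡b
  ... | tri> _ _ b≺a       = contradiction (rank-mono b≺a) (<-irrefl same-rank)
    where same-rank = trans (sym (toℕ-rankFin b)) (trans (cong toℕ (sym same)) (toℕ-rankFin a))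

  sortingPermutation : Permutation′ n
  sortingPermutation =
    permutation entry rankFin (rankFin-injective ∘ proj₂ ∘ surjective ∘ rankFin) (proj₂ ∘ surjective)
    where
    surjective = injective⇒surjective rankFin rankFin-injective
    entry : Fin n → Fin n
    entry = proj₁ ∘ surjective

  rank-sortingPermutation : ∀ k → rank (sortingPermutation ⟨$⟩ʳ k) ≡ toℕ k
  rank-sortingPermutation k = trans (sym (toℕ-rankFin _)) (cong toℕ (inverseˡ sortingPermutation))

  sortingPermutation-sorted : Sorted sortingPermutation
  sortingPermutation-sorted {k} {k′} k<k′
    with compare (sortingPermutation ⟨$⟩ʳ k) (sortingPermutation ⟨$⟩ʳ k′)
  ... | tri< πk≺πk′ _ _     = πk≺πk′
  ... | tri≈ _ (_ , same) _ = contradiction k<k′ (<-irrefl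
          (trans (sym (rank-sortingPermutation k)) (trans (cong rank same) (rank-sortingPermutation k′))))
  ... | tri> _ _ πk′≺πk     = contradiction k<k′ (<-asym
          (subst₂ _<_ (rank-sortingPermutation k′) (rank-sortingPermutation k) (rank-mono πk′≺πk)))

sorted-resp-≗ : ∀ {n} {f f′ : Fin n → ℕ} → f ≗ f′ → ∀ π →
                SortByHeight.Sorted f′ π → SortByHeight.Sorted f π
sorted-resp-≗ f≗f′ π sorted k<k′ with sorted k<k′
... | inj₁ lt        = inj₁ (subst₂ _<_ (sym (f≗f′ _)) (sym (f≗f′ _)) lt)
... | inj₂ (eq , lt) = inj₂ (trans (f≗f′ _) (trans eq (sym (f≗f′ _))) , lt)

module _ {r n : ℕ} (i j : Fin n) (c d : Fin r) where

  letterLt-true : letterLt (i , c) (j , d) ≡ true →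
                  toℕ d ≤ toℕ c × (toℕ c ≡ toℕ d → toℕ i < toℕ j)
  letterLt-true lt with toℕ d <? toℕ c
  ... | yes d<c = <⇒≤ d<c , λ c≡d → contradiction (sym c≡d) (<⇒≢ d<c)
  ... | no  _   with toℕ c <? toℕ d | toℕ i <? toℕ j
  ...   | yes _   | _       with () ← lt
  ...   | no  _   | no _    with () ← lt
  ...   | no  c≮d | yes i<j = ≮⇒≥ c≮d , λ _ → i<j

  letterLt-false : letterLt (i , c) (j , d) ≡ false →
                   toℕ c ≤ toℕ d × (toℕ c ≡ toℕ d → toℕ j ≤ toℕ i)
  letterLt-false nlt with toℕ d <? toℕ c
  ... | yes _   with () ← nlt
  ... | no  d≮c with toℕ c <? toℕ d | toℕ i <? toℕ j
  ...   | yes c<d | _       = <⇒≤ c<d , λ c≡d → contradiction c≡d (<⇒≢ c<d)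
  ...   | no  _   | yes _   with () ← nlt
  ...   | no  _   | no  i≮j = ≮⇒≥ d≮c , λ _ → ≮⇒≥ i≮j

module _ {r n : ℕ} where

  consecutiveExponent : Fin n × Fin r → Fin n × Fin r → ℕ
  consecutiveExponent (i , c) (j , c′) =
    if letterLt (j , c′) (i , c) then (r + toℕ c) ∸ toℕ c′ else toℕ c ∸ toℕ c′

  consecutiveExponent-colours : ∀ i j (c c′ : Fin r) →
    consecutiveExponent (i , c) (j , c′) + toℕ c′ ≡ toℕ c + r * 𝟙 (letterLt (j , c′) (i , c))
  consecutiveExponent-colours i j c c′ with letterLt (j , c′) (i , c) in descent
  ... | true  = begin
    r + toℕ c ∸ toℕ c′ + toℕ c′ ≡⟨ m∸n+n≡m (≤-trans (<⇒≤ (toℕ<n c′)) (m≤m+n r _)) ⟩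
    r + toℕ c                   ≡⟨ +-comm r (toℕ c) ⟩
    toℕ c + r                   ≡⟨ cong (toℕ c +_) (*-identityʳ r) ⟨
    toℕ c + r * 1               ∎
    where open ≡-Reasoning
  ... | false = begin
    toℕ c ∸ toℕ c′ + toℕ c′ ≡⟨ m∸n+n≡m (proj₁ (letterLt-false j i c′ c descent)) ⟩
    toℕ c                   ≡⟨ +-identityʳ (toℕ c) ⟨
    toℕ c + 0               ≡⟨ cong (toℕ c +_) (*-zeroʳ r) ⟨
    toℕ c + r * 0           ∎
    where open ≡-Reasoning

  consecutiveExponent≡0⇒ascent : ∀ i j (c c′ : Fin r) → consecutiveExponent (i , c) (j , c′) ≡ 0 →
                                 toℕ i ≤ toℕ j
  consecutiveExponent≡0⇒ascent i j c c′ zero-exp with letterLt (j , c′) (i , c) in descent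
  ... | true  = contradiction (m∸n≡0⇒m≤n zero-exp) (<⇒≱ (≤-trans (toℕ<n c′) (m≤m+n r (toℕ c))))
  ... | false = proj₂ c′-vs-c (≤-antisym (proj₁ c′-vs-c) (m∸n≡0⇒m≤n zero-exp))
    where c′-vs-c = letterLt-false j i c′ c descent

last-or-successor : ∀ {n} (k : Fin n) → suc (toℕ k) ≡ n ⊎ ∃[ k′ ] toℕ k′ ≡ suc (toℕ k)
last-or-successor {n} k with suc (toℕ k) <? n
... | yes k+1<n = inj₂ (fromℕ< k+1<n , toℕ-fromℕ< k+1<n)
... | no  k+1≮n = inj₁ (≤-antisym (toℕ<n k) (≮⇒≥ k+1≮n))

module _ {r n : ℕ} (g : ColPerm r n) where

  mexp-last : ∀ {k} → suc (toℕ k) ≡ n → mexp g k ≡ toℕ (c g k)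
  mexp-last {k} last with suc (toℕ k) <? n
  ... | yes k+1<n = contradiction k+1<n (<-irrefl last)
  ... | no  _     = refl

  mexp-next : ∀ {k k′} → toℕ k′ ≡ suc (toℕ k) →
              mexp g k ≡ consecutiveExponent (letter g k) (letter g k′)
  mexp-next {k} {k′} next with suc (toℕ k) <? n
  ... | yes k+1<n = cong (consecutiveExponent (letter g k) ∘ letter g)
                         (toℕ-injective (trans (toℕ-fromℕ< k+1<n) (sym next)))
  ... | no  k+1≮n = contradiction (subst (_< n) next (toℕ<n k′)) k+1≮n

-- The multichain of b̃_(g,d)

module _ {r n : ℕ} (g : ColPerm r n) where

  exponent : (Fin n → ℕ) → Fin n → ℕ
  exponent d k = mexp g k + r * d k

  chain : (Fin n → ℕ) → List (Subset n)
  chain d = blocks (exponent d) (Tset g)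

  Tset-lookup : ∀ k j → lookup (Tset g k) j ≡ (toℕ (σ g ⟨$⟩ˡ j) ≤ᵇ toℕ k)
  Tset-lookup k j = lookup∘tabulate _ j

  ∈-Tset⁻ : ∀ {k j} → j ∈ Tset g k → toℕ (σ g ⟨$⟩ˡ j) ≤ toℕ k
  ∈-Tset⁻ {k} {j} j∈T =
    ≤ᵇ⇒≤ _ _ (Equivalence.from T-≡ (trans (sym (Tset-lookup k j)) ([]=⇒lookup j∈T)))

  ∈-Tset⁺ : ∀ {k j} → toℕ (σ g ⟨$⟩ˡ j) ≤ toℕ k → j ∈ Tset g k
  ∈-Tset⁺ {k} {j} j≤k =
    lookup⇒[]= j (Tset g k) (trans (Tset-lookup k j) (Equivalence.to T-≡ (≤⇒≤ᵇ j≤k)))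

  chain-isMultichain : ∀ d → IsMultichain (chain d)
  chain-isMultichain d = blocks-isMultichain (exponent d) (Tset g)
    (λ k → σ g ⟨$⟩ʳ k , ∈-Tset⁺ (≤-reflexive (cong toℕ (inverseˡ (σ g)))))
    (λ k<k′ j∈T → ∈-Tset⁺ (≤-trans (∈-Tset⁻ j∈T) (<⇒≤ k<k′)))

  btilde≡prodY-chain : ∀ d S → btilde g d S ≡ prodY (chain d) S
  btilde≡prodY-chain d S = begin
    btilde g d S
      ≡⟨ ∑-allFin (λ k → if Tset g k ==S S then exponent d k else 0) ⟩
    ∑[ k < n ] (if Tset g k ==S S then exponent d k else 0)
      ≡⟨ tally-blocks (_==S S) (exponent d) (Tset g) ⟨
    tally (_==S S) (chain d)
      ≡⟨ prodY≡tally (chain d) S ⟨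
    prodY (chain d) S
      ∎
    where open ≡-Reasoning

  height-chain : ∀ d k → height (chain d) (σ g ⟨$⟩ʳ k) ≡ tailSum (exponent d) (toℕ k)
  height-chain d k = begin
    height (chain d) (σ g ⟨$⟩ʳ k)
      ≡⟨ tally-blocks _ (exponent d) (Tset g) ⟩
    ∑[ k′ < n ] (if lookup (Tset g k′) (σ g ⟨$⟩ʳ k) then exponent d k′ else 0)
      ≡⟨ sum-cong-≗ (λ k′ → cong (λ b → if b then exponent d k′ else 0) (Tset-lookup k′ _)) ⟩
    ∑[ k′ < n ] (if toℕ (σ g ⟨$⟩ˡ (σ g ⟨$⟩ʳ k)) ≤ᵇ toℕ k′ then exponent d k′ else 0)
      ≡⟨ cong (tailSum (exponent d) ∘ toℕ) (inverseˡ (σ g)) ⟩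
    tailSum (exponent d) (toℕ k)
      ∎
    where open ≡-Reasoning

module _ {r n : ℕ} (g : ColPerm r n) (d : Fin n → ℕ) where

  private
    f E C : Fin n → ℕ
    f = height (chain g d)
    E = exponent g d
    C k = toℕ (c g k)

  height-chain-step : ∀ {k k′} → toℕ k′ ≡ suc (toℕ k) →
                      f (σ g ⟨$⟩ʳ k) ≡ E k + f (σ g ⟨$⟩ʳ k′)
  height-chain-step {k} {k′} next = begin
    f (σ g ⟨$⟩ʳ k)                         ≡⟨ height-chain g d k ⟩
    tailSum E (toℕ k)                      ≡⟨ tailSum-step E (toℕ k) ⟩
    at E (toℕ k) + tailSum E (suc (toℕ k)) ≡⟨ cong₂ _+_ (at-toℕ E k) (cong (tailSum E) (sym next)) ⟩
    E k + tailSum E (toℕ k′)               ≡⟨ cong (E k +_) (height-chain g d k′) ⟨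
    E k + f (σ g ⟨$⟩ʳ k′)                  ∎
    where open ≡-Reasoning

  chain-sorted : SortByHeight.Sorted f (σ g)
  chain-sorted = ascending-if-adjacent {R = _≺_} ≺-trans (σ g ⟨$⟩ʳ_) adjacent
    where
    open SortByHeight f
    adjacent : ∀ {k k′} → toℕ k′ ≡ suc (toℕ k) → σ g ⟨$⟩ʳ k ≺ σ g ⟨$⟩ʳ k′
    adjacent {k} {k′} next with E k in E≡ | height-chain-step next
    ... | suc e | step = inj₁ (subst (f (σ g ⟨$⟩ʳ k′) <_) (sym step) (s≤s (m≤n+m _ e)))
    ... | zero  | step = inj₂ (step , ≤∧≢⇒< ascent distinct)
      where
      ascent = consecutiveExponent≡0⇒ascent (σ g ⟨$⟩ʳ k) (σ g ⟨$⟩ʳ k′) (c g k) (c g k′)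
                 (trans (sym (mexp-next g next)) (m+n≡0⇒m≡0 _ E≡))
      distinct : toℕ (σ g ⟨$⟩ʳ k) ≢ toℕ (σ g ⟨$⟩ʳ k′)
      distinct same = 1+n≢n (trans (sym next) (cong toℕ k′≡k))
        where
        k′≡k : k′ ≡ k
        k′≡k = trans (sym (inverseˡ (σ g)))
                     (trans (cong (σ g ⟨$⟩ˡ_) (toℕ-injective (sym same))) (inverseˡ (σ g)))

  exponent-telescopes : ∀ k → ∃[ D ] E k + at C (suc (toℕ k)) ≡ C k + r * D
  exponent-telescopes k with last-or-successor k
  ... | inj₁ last = d k , (begin
    mexp g k + r * d k + at C (suc (toℕ k))
      ≡⟨ cong₂ (λ m x → m + r * d k + x) (mexp-last g last) (at-≥ C (≤-reflexive (sym last))) ⟩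
    C k + r * d k + 0                       ≡⟨ +-identityʳ _ ⟩
    C k + r * d k                           ∎)
    where open ≡-Reasoning
  ... | inj₂ (k′ , next) = 𝟙 L + d k , (begin
    mexp g k + r * d k + at C (suc (toℕ k))
      ≡⟨ cong₂ (λ m x → m + r * d k + x) (mexp-next g next) (trans (cong (at C) (sym next)) (at-toℕ C _)) ⟩
    gap + r * d k + C k′
      ≡⟨ xy∙z≈xz∙y gap (r * d k) (C k′) ⟩
    gap + C k′ + r * d k
      ≡⟨ cong (_+ r * d k) (consecutiveExponent-colours (σ g ⟨$⟩ʳ k) (σ g ⟨$⟩ʳ k′) (c g k) (c g k′)) ⟩
    C k + r * 𝟙 L + r * d k
      ≡⟨ +-*-regroup r (C k) (𝟙 L) (d k) ⟩
    C k + r * (𝟙 L + d k)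
      ∎)
    where
    open ≡-Reasoning
    L = letterLt (letter g k′) (letter g k)
    gap = consecutiveExponent (letter g k) (letter g k′)

  colour≡height%r : .{{_ : NonZero r}} → ∀ k → C k ≡ f (σ g ⟨$⟩ʳ k) % r
  colour≡height%r k with Q , eq ← tailSum-telescope r E C exponent-telescopes (toℕ k) = begin
    C k                         ≡⟨ [m+r*k]%r≡m (C k) Q (toℕ<n (c g k)) ⟨
    (C k + r * Q) % r           ≡⟨ cong (λ x → (x + r * Q) % r) (at-toℕ C k) ⟨
    (at C (toℕ k) + r * Q) % r  ≡⟨ cong (_% r) (trans (sym eq) (sym (height-chain g d k))) ⟩
    f (σ g ⟨$⟩ʳ k) % r          ∎
    where open ≡-Reasoning

-- Uniqueness

module _ {r n : ℕ} .{{_ : NonZero r}} where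

  mexp-cong : ∀ (g g′ : ColPerm r n) → (∀ i → letter g i ≡ letter g′ i) →
              ∀ k → mexp g k ≡ mexp g′ k
  mexp-cong g g′ same k with last-or-successor k
  ... | inj₁ last        =
    trans (mexp-last g last) (trans (cong (toℕ ∘ proj₂) (same k)) (sym (mexp-last g′ last)))
  ... | inj₂ (k′ , next) =
    trans (mexp-next g next)
          (trans (cong₂ consecutiveExponent (same k) (same k′)) (sym (mexp-next g′ next)))

  chain-injective : ∀ g g′ (d d′ : Fin n → ℕ) → height (chain g d) ≗ height (chain g′ d′) →
                    SamePair (g , d) (g′ , d′)
  chain-injective g g′ d d′ same = same-entries , same-colours , same-d
    where
    same-entries : ∀ k → σ g ⟨$⟩ʳ k ≡ σ g′ ⟨$⟩ʳ k
    same-entries = SortByHeight.sorted-unique (height (chain g d)) (σ g) (σ g′)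
      (chain-sorted g d) (sorted-resp-≗ same (σ g′) (chain-sorted g′ d′))
    same-height : ∀ k → height (chain g d) (σ g ⟨$⟩ʳ k) ≡ height (chain g′ d′) (σ g′ ⟨$⟩ʳ k)
    same-height k = trans (same _) (cong (height (chain g′ d′)) (same-entries k))
    same-colours : ∀ k → c g k ≡ c g′ k
    same-colours k = toℕ-injective
      (trans (colour≡height%r g d k) (trans (cong (_% r) (same-height k)) (sym (colour≡height%r g′ d′ k))))
    same-exponents : exponent g d ≗ exponent g′ d′
    same-exponents = tailSum-injective λ k →
      trans (sym (height-chain g d k)) (trans (same-height k) (height-chain g′ d′ k))
    same-d : ∀ k → d k ≡ d′ k
    same-d k = *-cancelˡ-≡ (d k) (d′ k) r (+-cancelˡ-≡ (mexp g k) _ _ (trans (same-exponents k)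
      (cong (_+ r * d′ k) (sym (mexp-cong g g′ (λ i → cong₂ _,_ (same-entries i) (same-colours i)) k)))))

-- Existence

module _ {r : ℕ} .{{_ : NonZero r}} where

  descent-lowers-quotient : ∀ {n} (i j : Fin n) a b → b < a ⊎ (a ≡ b × toℕ i < toℕ j) →
                            𝟙 (letterLt (j , b mod r) (i , a mod r)) + b / r ≤ a / r
  descent-lowers-quotient i j a b order with letterLt (j , b mod r) (i , a mod r) in descent | order
  ... | false | inj₁ b<a          = /-monoˡ-≤ r (<⇒≤ b<a)
  ... | false | inj₂ (refl , _)   = ≤-refl
  ... | true  | inj₂ (refl , i<j) =
    contradiction i<j (<-asym (proj₂ (letterLt-true j i (b mod r) (a mod r) descent) refl))
  ... | true  | inj₁ b<a          = ≰⇒> λ a/r≤b/r → <⇒≱ b<a (begin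
    a                            ≡⟨ mod-div-decomposition a ⟩
    toℕ (a mod r) + r * (a / r)  ≤⟨ +-mono-≤ (proj₁ (letterLt-true j i (b mod r) (a mod r) descent))
                                             (*-monoʳ-≤ r a/r≤b/r) ⟩
    toℕ (b mod r) + r * (b / r)  ≡⟨ mod-div-decomposition b ⟨
    b                            ∎)
    where open ≤-Reasoning

module Realisation {r n : ℕ} .{{_ : NonZero r}} (f : Fin n → ℕ)
                   (π : Permutation′ n) (sorted : SortByHeight.Sorted f π) where

  private
    F : Fin n → ℕ
    F k = f (π ⟨$⟩ʳ k)

  g : ColPerm r n
  g = colperm π (λ k → F k mod r)

  exponent-solvable : ∀ k → ∃[ e ] mexp g k + r * e + at F (suc (toℕ k)) ≡ F k
  exponent-solvable k with last-or-successor k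
  ... | inj₁ last = F k / r , (begin
    mexp g k + r * (F k / r) + at F (suc (toℕ k))
      ≡⟨ cong₂ (λ m x → m + r * (F k / r) + x) (mexp-last g last) (at-≥ F (≤-reflexive (sym last))) ⟩
    toℕ (F k mod r) + r * (F k / r) + 0  ≡⟨ +-identityʳ _ ⟩
    toℕ (F k mod r) + r * (F k / r)      ≡⟨ mod-div-decomposition (F k) ⟨
    F k                                  ∎)
    where open ≡-Reasoning
  ... | inj₂ (k′ , next) with t , L+q′+t≡q ← m≤n⇒∃[o]m+o≡n {_ + F k′ / r} {F k / r}
                              (descent-lowers-quotient (π ⟨$⟩ʳ k) (π ⟨$⟩ʳ k′) (F k) (F k′)
                                                       (sorted (≤-reflexive (sym next)))) = t , (begin
    mexp g k + r * t + at F (suc (toℕ k))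
      ≡⟨ cong₂ (λ m x → m + r * t + x) (mexp-next g next) (trans (cong (at F) (sym next)) (at-toℕ F _)) ⟩
    gap + r * t + F k′
      ≡⟨ cong (gap + r * t +_) (mod-div-decomposition (F k′)) ⟩
    gap + r * t + (toℕ (F k′ mod r) + r * (F k′ / r))
      ≡⟨ +-*-carry r {gap} {toℕ (F k′ mod r)} {u = 𝟙 L} {F k′ / r} {t}
                   (consecutiveExponent-colours (π ⟨$⟩ʳ k) (π ⟨$⟩ʳ k′) (c g k) (c g k′)) L+q′+t≡q ⟩
    toℕ (F k mod r) + r * (F k / r)
      ≡⟨ mod-div-decomposition (F k) ⟨
    F k
      ∎)
    where
    open ≡-Reasoning
    gap = consecutiveExponent (letter g k) (letter g k′)
    L = letterLt (letter g k′) (letter g k)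

  d : Fin n → ℕ
  d = proj₁ ∘ exponent-solvable

  height-chain≗ : height (chain g d) ≗ f
  height-chain≗ j = begin
    height (chain g d) j                     ≡⟨ cong (height (chain g d)) (inverseʳ π) ⟨
    height (chain g d) (π ⟨$⟩ʳ (π ⟨$⟩ˡ j))   ≡⟨ height-chain g d _ ⟩
    tailSum (exponent g d) (toℕ (π ⟨$⟩ˡ j))
      ≡⟨ tailSum-of-differences _ F (proj₂ ∘ exponent-solvable) _ ⟩
    at F (toℕ (π ⟨$⟩ˡ j))                    ≡⟨ at-toℕ F _ ⟩
    f (π ⟨$⟩ʳ (π ⟨$⟩ˡ j))                    ≡⟨ cong f (inverseʳ π) ⟩
    f j                                      ∎
    where open ≡-Reasoning

mainTheorem6 : (r n : ℕ) → 1 ≤ r → 1 ≤ n →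
    (Ss : List (Subset n)) → IsMultichain Ss →
    Σ (ColPerm r n × (Fin n → ℕ)) λ gd →
      (prodY Ss ≈SR btilde (proj₁ gd) (proj₂ gd)) ×
      (∀ (gd' : ColPerm r n × (Fin n → ℕ)) →
         prodY Ss ≈SR btilde (proj₁ gd') (proj₂ gd') → SamePair gd gd')
mainTheorem6 zero    _ () _ _ _
mainTheorem6 (suc _) n _  _ Ss multichain = (g , d) , inj₁ represents , unique
  where
  open SortByHeight (height Ss) using (sortingPermutation; sortingPermutation-sorted)
  open Realisation (height Ss) sortingPermutation sortingPermutation-sorted
  chain≡Ss : chain g d ≡ Ss
  chain≡Ss = multichain-height-injective _ _ (chain-isMultichain g d) multichain height-chain≗
  represents : ∀ S → prodY Ss S ≡ btilde g d S
  represents S = trans (cong (λ L → prodY L S) (sym chain≡Ss)) (sym (btilde≡prodY-chain g d S))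
  unique : ∀ gd′ → prodY Ss ≈SR btilde (proj₁ gd′) (proj₂ gd′) → SamePair (g , d) gd′
  unique (g′ , d′) (inj₁ same)        = chain-injective g g′ d d′ λ j → trans (height-chain≗ j)
    (tally-↭ _ (prodY≗⇒↭ Ss (chain g′ d′) λ S → trans (same S) (btilde≡prodY-chain g′ d′ S)))
  unique (g′ , d′) (inj₂ (Ss∈I , _)) = contradiction Ss∈I (multichain∉SRIdeal multichain)
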